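{- Let $U$ be a set. For any subsets $A,B\subseteq U\times U$, $\operatorname{int}(A\cap B)=\operatorname{int}\left(\operatorname{int}(A)\cap\operatorname{int}(B)\right)$.
   Context: For $S\subseteq U\times U$, $\overline{S}$ denotes the reflexive–symmetric–transitive closure of $S$ (smallest equivalence relation on $U$ containing $S$), and $\operatorname{int}(S)=(U\times U)\setminus\overline{(U\times U)\setminus S}$. -}

module Defs where

open import Level using (Level; _⊔_)
open import Data.Product using (_×_)
open import Relation.Nullary using (¬_)
open import Relation.Binary.Core using (Rel)
open import Relation.Binary.Construct.Closure.Equivalence using (EqClosure)

-- A subset S ⊆ U × U is represented as a binary relation U → U → Set ℓ.

∁ : ∀ {a ℓ} {U : Set a} → Rel U ℓ → Rel U ℓ
∁ S x y = ¬ S x y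

_∩_ : ∀ {a ℓ} {U : Set a} → Rel U ℓ → Rel U ℓ → Rel U ℓ
(S ∩ T) x y = S x y × T x y

closure : ∀ {a ℓ} {U : Set a} → Rel U ℓ → Rel U (a ⊔ ℓ)
closure S = EqClosure S

int : ∀ {a ℓ} {U : Set a} → Rel U ℓ → Rel U (a ⊔ ℓ)
int S = ∁ (closure (∁ S))

_≐_ : ∀ {a ℓ₁ ℓ₂} {U : Set a} → Rel U ℓ₁ → Rel U ℓ₂ → Set (a ⊔ ℓ₁ ⊔ ℓ₂)
S ≐ T = ∀ x y → (S x y → T x y) × (T x y → S x y)

module Submission where

-- int is monotone, and int S ⊆ int (int S) because the complement of int S,
-- the double negation of an equivalence closure, is again an equivalence
-- relation; this gives ⊆. Constructively int S only yields ¬ ¬ S, but that is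
-- enough for ⊇: ¬ ¬ A and ¬ ¬ B refute every pair outside A ∩ B.

open import Defs
open import Level using (Level)
open import Data.Product using (_,_; proj₁; proj₂)
open import Function.Base using (id; _∘_)
open import Relation.Binary.Core using (Rel; _⇒_)
open import Relation.Binary.Structures using (IsEquivalence)
open import Relation.Nullary.Negation using (¬_; contraposition; ¬¬-map)
import Relation.Binary.Construct.Closure.Equivalence as EqClosure

private
  variable
    a ℓ ℓ₁ ℓ₂ : Level
    U : Set a
    S : Rel U ℓ₁
    T : Rel U ℓ₂

¬¬-closure-isEquivalence : (R : Rel U ℓ) →
  IsEquivalence (λ x y → ¬ ¬ closure R x y)
¬¬-closure-isEquivalence R = record
  { refl  = λ k → k (EqClosure.reflexive R)
  ; sym   = ¬¬-map (EqClosure.symmetric R)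
  ; trans = λ p q k → p (λ c → q (λ d → k (EqClosure.transitive R c d)))
  }

int-mono-∁ : ∁ T ⇒ ∁ S → int S ⇒ int T
int-mono-∁ ∁T⇒∁S i = i ∘ EqClosure.map ∁T⇒∁S

int-mono : S ⇒ T → int S ⇒ int T
int-mono S⇒T = int-mono-∁ (contraposition S⇒T)

int⇒¬¬ : ∀ {x y} → int S x y → ¬ ¬ S x y
int⇒¬¬ i ¬s = i (EqClosure.return ¬s)

int⇒int-int : int S ⇒ int (int S)
int⇒int-int {S = S} i c = EqClosure.fold (¬¬-closure-isEquivalence (∁ S)) id c i

mainTheorem5 : ∀ {a ℓ} {U : Set a} (A B : Rel U ℓ) →
    int (A ∩ B) ≐ int (int A ∩ int B)
mainTheorem5 A B x y = int-mono int-∩⇒∩-int ∘ int⇒int-int , int-mono-∁ ∁∩⇒∁∩-int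
  where
  int-∩⇒∩-int : int (A ∩ B) ⇒ (int A ∩ int B)
  int-∩⇒∩-int i = int-mono proj₁ i , int-mono proj₂ i

  ∁∩⇒∁∩-int : ∁ (A ∩ B) ⇒ ∁ (int A ∩ int B)
  ∁∩⇒∁∩-int ¬ab (iA , iB) = int⇒¬¬ iB (λ b → int⇒¬¬ iA (λ a → ¬ab (a , b)))
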